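{- Let $X$ be a finite set containing a fixed element $\infty$, let $<$ be a linear ordering of $X$, and let $T:=\{(\infty,a,b): a,b\in X\setminus\{\infty\},\ a<b\}$. For every $y\in\mathrm{GF}(2)^T$ there is a unique vector $u\in\mathcal{U}^X$ such that the restriction of $u$ to the entries indexed by $T$ equals $y$.
   Context: $\mathcal{U}^X$ is the affine subspace of all $u\in\mathrm{GF}(2)^{X^3}$ such that: $u(x,x,y)=0$ for all $x,y\in X$; $u(x,y,z)+u(y,z,x)=0$ for all $x,y,z\in X$; $u(x,y,z)+u(y,x,z)=1$ for all pairwise distinct $x,y,z\in X$; and $u(t,x,y)+u(t,x,z)+u(t,y,z)+u(x,y,z)=0$ for all pairwise distinct $t,x,y,z\in X$. -}

module Defs where

open import Data.Nat using (ℕ)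
open import Data.Fin using (Fin)
open import Data.Bool using (Bool; true; false; _xor_)
open import Data.Product using (Σ; _×_; _,_; ∃)
open import Relation.Binary.PropositionalEquality using (_≡_; _≢_)
open import Relation.Binary.Core using (Rel)
open import Level using (0ℓ)

-- GF(2) is modelled by Bool with addition _xor_ (false = 0, true = 1).

GF2^X³ : ℕ → Set
GF2^X³ n = Fin n → Fin n → Fin n → Bool

record In𝒰 {n : ℕ} (u : GF2^X³ n) : Set where
  field
    diag  : ∀ x y → u x x y ≡ false
    cyc   : ∀ x y z → (u x y z xor u y z x) ≡ false
    swap  : ∀ x y z → x ≢ y → y ≢ z → x ≢ z → (u x y z xor u y x z) ≡ true
    four  : ∀ t x y z → t ≢ x → t ≢ y → t ≢ z → x ≢ y → x ≢ z → y ≢ z →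
            (u t x y xor u t x z xor u t y z xor u x y z) ≡ false

-- Index set T = {(∞,a,b) : a,b ∈ X∖{∞}, a < b}, recorded by the pair (a , b);
-- proofs are irrelevant so that a vector in GF(2)^T depends only on (a , b).
record T {n : ℕ} (∞ : Fin n) (_<_ : Rel (Fin n) 0ℓ) : Set where
  constructor mkT
  field
    a b  : Fin n
    .a≢∞ : a ≢ ∞
    .b≢∞ : b ≢ ∞
    .a<b : a < b

RestrictsTo : {n : ℕ} (∞ : Fin n) (_<_ : Rel (Fin n) 0ℓ) →
              GF2^X³ n → (T ∞ _<_ → Bool) → Set
RestrictsTo ∞ _<_ u y = ∀ (t : T ∞ _<_) → u ∞ (T.a t) (T.b t) ≡ y t

-- Orient the complete graph on X: every a ≠ ∞ points to ∞, and for a < b the edge goes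
-- a → b iff y(a,b) = 1.  With e(a,b) = 1 meaning a → b, u(x,y,z) := 1 + e(x,y) + e(y,z) + e(z,x)
-- on pairwise distinct triples (0 elsewhere) satisfies the relations of 𝒰, the four-term one
-- because every edge of a tetrahedron lies on two of its faces; and u(∞,a,b) = 0 + y(a,b) + 1 + 1.
-- Conversely, the relations of 𝒰 force w = 0 on triples with a repeated entry, let one rotate
-- ∞ into the first position, and give w(∞,b,a) = 1 + w(∞,a,b) and
-- w(x,y,z) = w(∞,x,y) + w(∞,x,z) + w(∞,y,z); so w is determined by its restriction to T.
module Submission where

open import Defs
open import Data.Nat using (ℕ)
open import Data.Fin using (Fin; _≟_)
open import Data.Bool using (Bool; true; false; not; _xor_)
import Data.Bool.Properties as Bool
open import Data.Product using (Σ; _×_; _,_)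
open import Data.Empty using (⊥-elim; ⊥-elim-irr)
open import Relation.Nullary using (Dec; yes; no)
open import Relation.Nullary.Decidable using (toWitness; _→-dec_)
open import Relation.Binary.PropositionalEquality
  using (_≡_; _≢_; refl; sym; trans; cong; cong₂; ≢-sym; module ≡-Reasoning)
open import Relation.Binary.Core using (Rel)
open import Relation.Binary.Definitions using (Trichotomous; tri<; tri≈; tri>)
open import Relation.Binary.Structures using (IsStrictTotalOrder)
open import Relation.Binary.Consequences using (tri⇒irr)
open import Level using (0ℓ)

∀-Bool? : {P : Bool → Set} → (∀ b → Dec (P b)) → Dec (∀ b → P b)
∀-Bool? P? with P? false | P? true
... | yes pf  | yes pt  = yes λ { false → pf ; true → pt }
... | no ¬pf  | _       = no λ p → ¬pf (p false)
... | yes _   | no ¬pt  = no λ p → ¬pt (p true)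

xor≡false⇒≡ : ∀ a b → a xor b ≡ false → a ≡ b
xor≡false⇒≡ = toWitness {a? = ∀-Bool? λ a → ∀-Bool? λ b → (_ Bool.≟ _) →-dec (_ Bool.≟ _)} _

xor≡true⇒≡not : ∀ a b → a xor b ≡ true → a ≡ not b
xor≡true⇒≡not = toWitness {a? = ∀-Bool? λ a → ∀-Bool? λ b → (_ Bool.≟ _) →-dec (_ Bool.≟ _)} _

xor≡false⇒last : ∀ a b c d → a xor b xor c xor d ≡ false → d ≡ a xor b xor c
xor≡false⇒last = toWitness {a? = ∀-Bool? λ a → ∀-Bool? λ b → ∀-Bool? λ c → ∀-Bool? λ d →
  (_ Bool.≟ _) →-dec (_ Bool.≟ _)} _

δ : Bool → Bool → Bool → Bool
δ a b c = a xor b xor c xor true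

δ-rotate : ∀ a b c → δ a b c ≡ δ b c a
δ-rotate = toWitness {a? = ∀-Bool? λ a → ∀-Bool? λ b → ∀-Bool? λ c → _ Bool.≟ _} _

δ-reverse : ∀ a b c → δ a b c xor δ (not a) (not c) (not b) ≡ true
δ-reverse = toWitness {a? = ∀-Bool? λ a → ∀-Bool? λ b → ∀-Bool? λ c → _ Bool.≟ _} _

δ-tetrahedron : ∀ tx xy yt xz zt yz →
  δ tx xy yt xor δ tx xz zt xor δ (not yt) yz zt xor δ xy yz (not xz) ≡ false
δ-tetrahedron = toWitness {a? = ∀-Bool? λ a → ∀-Bool? λ b → ∀-Bool? λ c →
  ∀-Bool? λ d → ∀-Bool? λ e → ∀-Bool? λ f → _ Bool.≟ _} _

module In𝒰-Properties {n : ℕ} {w : GF2^X³ n} (w∈𝒰 : In𝒰 w) where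
  open In𝒰 w∈𝒰

  rotate : ∀ x y z → w x y z ≡ w y z x
  rotate x y z = xor≡false⇒≡ _ _ (cyc x y z)

  vanish-xyy : ∀ x y → w x y y ≡ false
  vanish-xyy x y = trans (rotate x y y) (diag y x)

  vanish-xyx : ∀ x y → w x y x ≡ false
  vanish-xyx x y = trans (rotate x y x) (vanish-xyy y x)

  flip : ∀ {t a b} → a ≢ b → b ≢ t → a ≢ t → w t a b ≡ not (w t b a)
  flip {t} {a} {b} a≢b b≢t a≢t = begin
    w t a b        ≡⟨ rotate t a b ⟩
    w a b t        ≡⟨ xor≡true⇒≡not _ _ (swap a b t a≢b b≢t a≢t) ⟩
    not (w b a t)  ≡⟨ cong not (rotate t b a) ⟨
    not (w t b a)  ∎
    where open ≡-Reasoning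

  expand : ∀ {t x y z} → t ≢ x → t ≢ y → t ≢ z → x ≢ y → x ≢ z → y ≢ z →
           w x y z ≡ w t x y xor w t x z xor w t y z
  expand {t} {x} {y} {z} t≢x t≢y t≢z x≢y x≢z y≢z =
    xor≡false⇒last (w t x y) (w t x z) (w t y z) (w x y z) (four t x y z t≢x t≢y t≢z x≢y x≢z y≢z)

open In𝒰-Properties

module _ {n : ℕ} {v w : GF2^X³ n} (v∈𝒰 : In𝒰 v) (w∈𝒰 : In𝒰 w) where

  agree-on-link⇒agree : ∀ {t} → (∀ a b → v t a b ≡ w t a b) → ∀ x y z → v x y z ≡ w x y z
  agree-on-link⇒agree {t} agree x y z with x ≟ y | y ≟ z | x ≟ z
  ... | yes refl | _        | _        = trans (In𝒰.diag v∈𝒰 x z) (sym (In𝒰.diag w∈𝒰 x z))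
  ... | no _     | yes refl | _        = trans (vanish-xyy v∈𝒰 x y) (sym (vanish-xyy w∈𝒰 x y))
  ... | no _     | no _     | yes refl = trans (vanish-xyx v∈𝒰 x y) (sym (vanish-xyx w∈𝒰 x y))
  ... | no x≢y   | no y≢z   | no x≢z with x ≟ t | y ≟ t | z ≟ t
  ...   | yes refl | _        | _        = agree y z
  ...   | no _     | yes refl | _        =
    trans (rotate v∈𝒰 x t z) (trans (agree z x) (sym (rotate w∈𝒰 x t z)))
  ...   | no _     | no _     | yes refl =
    trans (sym (rotate v∈𝒰 t x y)) (trans (agree x y) (rotate w∈𝒰 t x y))
  ...   | no x≢t   | no y≢t   | no z≢t   = begin
    v x y z                             ≡⟨ expand v∈𝒰 t≢x t≢y t≢z x≢y x≢z y≢z ⟩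
    v t x y xor v t x z xor v t y z     ≡⟨ cong₂ _xor_ (agree x y) (cong₂ _xor_ (agree x z) (agree y z)) ⟩
    w t x y xor w t x z xor w t y z     ≡⟨ expand w∈𝒰 t≢x t≢y t≢z x≢y x≢z y≢z ⟨
    w x y z                             ∎
    where
    open ≡-Reasoning
    t≢x : t ≢ x
    t≢x = ≢-sym x≢t
    t≢y : t ≢ y
    t≢y = ≢-sym y≢t
    t≢z : t ≢ z
    t≢z = ≢-sym z≢t

  agree-on-ordered-link⇒agree-on-link :
    ∀ {t} {_<_ : Rel (Fin n) 0ℓ} → Trichotomous _≡_ _<_ →
    (∀ a b → a ≢ t → b ≢ t → a < b → v t a b ≡ w t a b) →
    ∀ a b → v t a b ≡ w t a b
  agree-on-ordered-link⇒agree-on-link {t} compare agree a b with a ≟ b | a ≟ t | b ≟ t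
  ... | yes refl | _        | _        = trans (vanish-xyy v∈𝒰 t a) (sym (vanish-xyy w∈𝒰 t a))
  ... | no _     | yes refl | _        = trans (In𝒰.diag v∈𝒰 t b) (sym (In𝒰.diag w∈𝒰 t b))
  ... | no _     | no _     | yes refl = trans (vanish-xyx v∈𝒰 t a) (sym (vanish-xyx w∈𝒰 t a))
  ... | no a≢b   | no a≢t   | no b≢t with compare a b
  ...   | tri< a<b _ _ = agree a b a≢t b≢t a<b
  ...   | tri≈ _ a≡b _ = ⊥-elim (a≢b a≡b)
  ...   | tri> _ _ b<a = begin
    v t a b        ≡⟨ flip v∈𝒰 a≢b b≢t a≢t ⟩
    not (v t b a)  ≡⟨ cong not (agree b a b≢t a≢t b<a) ⟩
    not (w t b a)  ≡⟨ flip w∈𝒰 a≢b b≢t a≢t ⟨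
    w t a b        ∎
    where open ≡-Reasoning

restriction-injective :
  ∀ {n} {∞ : Fin n} {_<_ : Rel (Fin n) 0ℓ} {y : T ∞ _<_ → Bool} {v w : GF2^X³ n} →
  Trichotomous _≡_ _<_ → In𝒰 v → In𝒰 w →
  RestrictsTo ∞ _<_ v y → RestrictsTo ∞ _<_ w y →
  ∀ x₁ x₂ x₃ → v x₁ x₂ x₃ ≡ w x₁ x₂ x₃
restriction-injective compare v∈𝒰 w∈𝒰 v↾y w↾y =
  agree-on-link⇒agree v∈𝒰 w∈𝒰 (agree-on-ordered-link⇒agree-on-link v∈𝒰 w∈𝒰 compare
    λ a b a≢∞ b≢∞ a<b → trans (v↾y (mkT a b a≢∞ b≢∞ a<b)) (sym (w↾y (mkT a b a≢∞ b≢∞ a<b))))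

IsTournament : {n : ℕ} → (Fin n → Fin n → Bool) → Set
IsTournament e = ∀ {a b} → a ≢ b → e b a ≡ not (e a b)

fromTournament : {n : ℕ} → (Fin n → Fin n → Bool) → GF2^X³ n
fromTournament e x y z with x ≟ y | y ≟ z | z ≟ x
... | no _ | no _ | no _ = δ (e x y) (e y z) (e z x)
... | _    | _    | _    = false

module _ {n : ℕ} (e : Fin n → Fin n → Bool) where

  fromTournament-distinct : ∀ {x y z} → .(x ≢ y) → .(y ≢ z) → .(z ≢ x) →
                            fromTournament e x y z ≡ δ (e x y) (e y z) (e z x)
  fromTournament-distinct {x} {y} {z} x≢y y≢z z≢x with x ≟ y | y ≟ z | z ≟ x
  ... | no _    | no _    | no _    = refl
  ... | yes x≡y | _       | _       = ⊥-elim-irr (x≢y x≡y)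
  ... | no _    | yes y≡z | _       = ⊥-elim-irr (y≢z y≡z)
  ... | no _    | no _    | yes z≡x = ⊥-elim-irr (z≢x z≡x)

  fromTournament-diag : ∀ x y → fromTournament e x x y ≡ false
  fromTournament-diag x y with x ≟ x
  ... | yes _  = refl
  ... | no x≢x = ⊥-elim (x≢x refl)

  fromTournament-rotate : ∀ x y z → fromTournament e x y z ≡ fromTournament e y z x
  fromTournament-rotate x y z with x ≟ y | y ≟ z | z ≟ x
  ... | no _  | no _  | no _  = δ-rotate (e x y) (e y z) (e z x)
  ... | no _  | no _  | yes _ = refl
  ... | no _  | yes _ | no _  = refl
  ... | no _  | yes _ | yes _ = refl
  ... | yes _ | no _  | no _  = refl
  ... | yes _ | no _  | yes _ = refl
  ... | yes _ | yes _ | no _  = refl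
  ... | yes _ | yes _ | yes _ = refl

module _ {n : ℕ} {e : Fin n → Fin n → Bool} (tournament : IsTournament e) where

  fromTournament-swap : ∀ x y z → x ≢ y → y ≢ z → x ≢ z →
                        fromTournament e x y z xor fromTournament e y x z ≡ true
  fromTournament-swap x y z x≢y y≢z x≢z
    rewrite fromTournament-distinct e x≢y y≢z (≢-sym x≢z)
          | fromTournament-distinct e (≢-sym x≢y) x≢z (≢-sym y≢z)
          | tournament x≢y | tournament y≢z | tournament (≢-sym x≢z)
    = δ-reverse (e x y) (e y z) (e z x)

  fromTournament-four : ∀ t x y z → t ≢ x → t ≢ y → t ≢ z → x ≢ y → x ≢ z → y ≢ z →
    fromTournament e t x y xor fromTournament e t x z xor fromTournament e t y z
      xor fromTournament e x y z ≡ false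
  fromTournament-four t x y z t≢x t≢y t≢z x≢y x≢z y≢z
    rewrite fromTournament-distinct e t≢x x≢y (≢-sym t≢y)
          | fromTournament-distinct e t≢x x≢z (≢-sym t≢z)
          | fromTournament-distinct e t≢y y≢z (≢-sym t≢z)
          | fromTournament-distinct e x≢y y≢z (≢-sym x≢z)
          | tournament (≢-sym t≢y) | tournament x≢z
    = δ-tetrahedron (e t x) (e x y) (e y t) (e x z) (e z t) (e y z)

  fromTournament-∈𝒰 : In𝒰 (fromTournament e)
  fromTournament-∈𝒰 = record
    { diag = fromTournament-diag e
    ; cyc  = λ x y z → trans (cong (fromTournament e x y z xor_) (sym (fromTournament-rotate e x y z)))
                               (Bool.xor-same (fromTournament e x y z))
    ; swap = fromTournament-swap
    ; four = fromTournament-four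
    }

module _ {n : ℕ} {∞ : Fin n} {_<_ : Rel (Fin n) 0ℓ} (compare : Trichotomous _≡_ _<_)
         (y : T ∞ _<_ → Bool) where

  orient : Fin n → Fin n → Bool
  orient a b with a ≟ ∞ | b ≟ ∞ | compare a b
  ... | yes _   | _       | _            = false
  ... | no _    | yes _   | _            = true
  ... | no a≢∞  | no b≢∞  | tri< a<b _ _ = y (mkT a b a≢∞ b≢∞ a<b)
  ... | no _    | no _    | tri≈ _ _ _   = false
  ... | no a≢∞  | no b≢∞  | tri> _ _ b<a = not (y (mkT b a b≢∞ a≢∞ b<a))

  orient-isTournament : IsTournament orient
  orient-isTournament {a} {b} a≢b with a ≟ ∞ | b ≟ ∞ | compare a b | compare b a
  ... | yes refl | yes refl | _            | _            = ⊥-elim (a≢b refl)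
  ... | yes _    | no _     | _            | _            = refl
  ... | no _     | yes _    | _            | _            = refl
  ... | no _     | no _     | tri≈ _ a≡b _ | _            = ⊥-elim (a≢b a≡b)
  ... | no _     | no _     | _            | tri≈ _ b≡a _ = ⊥-elim (a≢b (sym b≡a))
  ... | no _     | no _     | tri< a<b _ _ | tri< _ _ ¬a<b = ⊥-elim (¬a<b a<b)
  ... | no _     | no _     | tri> _ _ b<a | tri> ¬b<a _ _ = ⊥-elim (¬b<a b<a)
  ... | no _     | no _     | tri< _ _ _   | tri> _ _ _   = refl
  ... | no _     | no _     | tri> _ _ _   | tri< _ _ _   = sym (Bool.not-involutive _)

  orient-∞ˡ : ∀ b → orient ∞ b ≡ false
  orient-∞ˡ b with ∞ ≟ ∞
  ... | yes _  = refl
  ... | no ∞≢∞ = ⊥-elim (∞≢∞ refl)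

  orient-∞ʳ : ∀ {a} → .(a ≢ ∞) → orient a ∞ ≡ true
  orient-∞ʳ {a} a≢∞ with a ≟ ∞ | ∞ ≟ ∞
  ... | yes a≡∞ | _      = ⊥-elim-irr (a≢∞ a≡∞)
  ... | no _    | yes _  = refl
  ... | no _    | no ∞≢∞ = ⊥-elim (∞≢∞ refl)

  orient-< : ∀ {a b} .(a≢∞ : a ≢ ∞) .(b≢∞ : b ≢ ∞) .(a<b : a < b) →
             orient a b ≡ y (mkT a b a≢∞ b≢∞ a<b)
  orient-< {a} {b} a≢∞ b≢∞ a<b with a ≟ ∞ | b ≟ ∞ | compare a b
  ... | yes a≡∞ | _       | _             = ⊥-elim-irr (a≢∞ a≡∞)
  ... | no _    | yes b≡∞ | _             = ⊥-elim-irr (b≢∞ b≡∞)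
  ... | no _    | no _    | tri< _ _ _    = refl
  ... | no _    | no _    | tri≈ ¬a<b _ _ = ⊥-elim-irr (¬a<b a<b)
  ... | no _    | no _    | tri> ¬a<b _ _ = ⊥-elim-irr (¬a<b a<b)

  fromTournament-orient-restrictsTo : RestrictsTo ∞ _<_ (fromTournament orient) y
  fromTournament-orient-restrictsTo (mkT a b a≢∞ b≢∞ a<b) = begin
    fromTournament orient ∞ a b               ≡⟨ fromTournament-distinct orient (≢-sym a≢∞)
                                                   (λ a≡b → tri⇒irr compare a≡b a<b) b≢∞ ⟩
    δ (orient ∞ a) (orient a b) (orient b ∞)  ≡⟨ cong₂ (λ p q → δ p q (orient b ∞))
                                                   (orient-∞ˡ a) (orient-< a≢∞ b≢∞ a<b) ⟩
    δ false yab (orient b ∞)                  ≡⟨ cong (δ false yab) (orient-∞ʳ b≢∞) ⟩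
    δ false yab true                          ≡⟨ Bool.xor-identityʳ yab ⟩
    yab                                       ∎
    where
    open ≡-Reasoning
    yab : Bool
    yab = y (mkT a b a≢∞ b≢∞ a<b)

lemma8 : (n : ℕ) (∞ : Fin n) (_<_ : Rel (Fin n) 0ℓ) →
    IsStrictTotalOrder _≡_ _<_ →
    (y : T ∞ _<_ → Bool) →
    Σ (GF2^X³ n) (λ u → (In𝒰 u × RestrictsTo ∞ _<_ u y) ×
    ((v : GF2^X³ n) → In𝒰 v → RestrictsTo ∞ _<_ v y →
    ∀ x₁ x₂ x₃ → v x₁ x₂ x₃ ≡ u x₁ x₂ x₃))
lemma8 n ∞ _<_ sto y = u , (u∈𝒰 , u↾y) , λ v v∈𝒰 v↾y → restriction-injective compare v∈𝒰 u∈𝒰 v↾y u↾y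
  where
  open IsStrictTotalOrder sto using (compare)
  u : GF2^X³ n
  u = fromTournament (orient compare y)
  u∈𝒰 : In𝒰 u
  u∈𝒰 = fromTournament-∈𝒰 (orient-isTournament compare y)
  u↾y : RestrictsTo ∞ _<_ u y
  u↾y = fromTournament-orient-restrictsTo compare y
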